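{- Let $G$ be a connected block graph with blocks $B_1, B_2, \ldots, B_t$. Then the number $nm(G)$ of non-modular triples of $G$ satisfies $$nm(G)= \sum_{i=1}^t N_3(G \setminus B_i).$$
   Context: A block of a graph is a maximal connected induced subgraph without cut vertices; a block graph is a graph in which every block is a clique. For a block $B_i$, $G\setminus B_i$ denotes the graph obtained from $G$ by deleting all edges of $B_i$ (keeping all vertices). For a graph $H$ with connected components $H_1,\ldots,H_p$ and $n(H_j)=|V(H_j)|$, define $N_3(H)=\sum_{\{i,j,k\}\subseteq\{1,\ldots,p\}} n(H_i)\,n(H_j)\,n(H_k)$ (sum over $3$-element subsets) if $p\ge3$, and $N_3(H)=0$ if $p<3$. The interval $I(u,v)$ is the set of vertices lying on some shortest $u,v$-path in $G$. A set $\{x,y,z\}$ of three distinct vertices is a non-modular triple if $I(x,y)\cap I(x,z)\cap I(y,z)=\emptyset$; $nm(G)$ is the number of such sets. -}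

module Defs where

open import Data.Nat using (ℕ; zero; suc; _+_; _*_; _≤_)
open import Data.Bool using (Bool; true; false; _∧_; not)
open import Data.Fin using (Fin; _<_; _≟_)
open import Data.Fin.Subset using (Subset; _∈_; _∉_; _⊆_; _-_)
open import Data.Vec using (lookup)
open import Data.Product using (Σ; ∃; _×_; _,_)
open import Data.List using (List; length)
open import Data.List.Relation.Unary.All using (All)
open import Data.List.Relation.Unary.Unique.Propositional using (Unique)
import Data.List.Membership.Propositional as LM
open import Relation.Nullary using (¬_; Dec; yes; no)
open import Relation.Binary.PropositionalEquality using (_≡_; _≢_)
open import Function.Bundles using (_⇔_)

record Graph (n : ℕ) : Set where
  field
    E     : Fin n → Fin n → Bool
    sym   : ∀ u v → E u v ≡ E v u
    irrefl : ∀ u → E u u ≡ false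
open Graph public

data Walk {n : ℕ} (G : Graph n) : Fin n → Fin n → ℕ → Set where
  here : ∀ {u} → Walk G u u 0
  step : ∀ {u v w k} → E G u v ≡ true → Walk G v w k → Walk G u w (suc k)

data OnWalk {n : ℕ} {G : Graph n} (x : Fin n) :
            ∀ {u v k} → Walk G u v k → Set where
  at-start : ∀ {u v k} (p : Walk G u v k) → x ≡ u → OnWalk x p
  later    : ∀ {u v w k} (e : E G u v ≡ true) (p : Walk G v w k) →
             OnWalk x p → OnWalk x (step e p)

Reachable : ∀ {n} → Graph n → Fin n → Fin n → Set
Reachable G u v = ∃ λ k → Walk G u v k

Connected : ∀ {n} → Graph n → Set
Connected G = ∀ u v → Reachable G u v

-- A walk from u to v of length k is a shortest u,v-path if no u,v-walk is
-- shorter (such a walk is automatically a path).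
IsShortest : ∀ {n} (G : Graph n) (u v : Fin n) (k : ℕ) → Set
IsShortest G u v k = ∀ k' → Walk G u v k' → k ≤ k'

InInterval : ∀ {n} (G : Graph n) (u v w : Fin n) → Set
InInterval G u v w =
  Σ ℕ λ k → Σ (Walk G u v k) λ p → IsShortest G u v k × OnWalk w p

-- {x,y,z} (encoded as x < y < z) is a non-modular triple.
NonModular : ∀ {n} (G : Graph n) → Fin n × Fin n × Fin n → Set
NonModular G (x , y , z) =
  x < y × y < z ×
  ¬ (∃ λ w → InInterval G x y w × InInterval G x z w × InInterval G y z w)

-- "The number of triples satisfying P is m": there is a duplicate-free
-- list of exactly the triples satisfying P, of length m.
Count : ∀ {n} → (Fin n × Fin n × Fin n → Set) → ℕ → Set
Count {n} P m =
  Σ (List (Fin n × Fin n × Fin n)) λ L →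
    Unique L × All P L × (∀ t → P t → t LM.∈ L) × length L ≡ m

-- Induced subgraph G[S], kept on vertex set Fin n (vertices outside S
-- become isolated; connectivity is only asked between vertices of S).
induce : ∀ {n} → Graph n → Subset n → Graph n
induce G S = record
  { E = λ u v → E G u v ∧ lookup S u ∧ lookup S v
  ; sym = λ u v → symLemma u v
  ; irrefl = λ u → irrLemma u }
  where
  open import Data.Bool.Properties using (∧-comm; ∧-assoc)
  open import Relation.Binary.PropositionalEquality using (cong; cong₂; trans)
  symLemma : ∀ u v → E G u v ∧ lookup S u ∧ lookup S v ≡ E G v u ∧ lookup S v ∧ lookup S u
  symLemma u v rewrite Graph.sym G u v with lookup S u | lookup S v
  ... | true | true = Relation.Binary.PropositionalEquality.refl
  ... | true | false = Relation.Binary.PropositionalEquality.refl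
  ... | false | true = Relation.Binary.PropositionalEquality.refl
  ... | false | false = Relation.Binary.PropositionalEquality.refl
  irrLemma : ∀ u → E G u u ∧ lookup S u ∧ lookup S u ≡ false
  irrLemma u rewrite Graph.irrefl G u = Relation.Binary.PropositionalEquality.refl
  open import Relation.Nullary using ()

ConnectedOn : ∀ {n} → Graph n → Subset n → Set
ConnectedOn G S = ∀ u v → u ∈ S → v ∈ S → Reachable (induce G S) u v

Biconn : ∀ {n} → Graph n → Subset n → Set
Biconn G S = ConnectedOn G S × (∀ v → v ∈ S → ConnectedOn G (S - v))

IsBlock : ∀ {n} → Graph n → Subset n → Set
IsBlock G S = Biconn G S × (∀ T → S ⊆ T → Biconn G T → T ≡ S)

IsClique : ∀ {n} → Graph n → Subset n → Set
IsClique G S = ∀ u v → u ∈ S → v ∈ S → u ≢ v → E G u v ≡ true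

IsBlockGraph : ∀ {n} → Graph n → Set
IsBlockGraph G = ∀ S → IsBlock G S → IsClique G S

-- G ∖ B: delete all edges with both ends in B (all vertices kept).
deleteEdges : ∀ {n} → Graph n → Subset n → Graph n
deleteEdges G B = record
  { E = λ u v → E G u v ∧ not (lookup B u ∧ lookup B v)
  ; sym = symL
  ; irrefl = λ u → irrL u }
  where
  open import Relation.Binary.PropositionalEquality using (refl)
  open import Data.Bool.Properties using (∧-comm)
  symL : ∀ u v → E G u v ∧ not (lookup B u ∧ lookup B v) ≡ E G v u ∧ not (lookup B v ∧ lookup B u)
  symL u v rewrite Graph.sym G u v | ∧-comm (lookup B u) (lookup B v) = refl
  irrL : ∀ u → E G u u ∧ not (lookup B u ∧ lookup B u) ≡ false
  irrL u rewrite Graph.irrefl G u = refl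

∑ : ∀ {p} → (Fin p → ℕ) → ℕ
∑ {zero} f = 0
∑ {suc p} f = f Fin.zero + ∑ (λ i → f (Fin.suc i))
  where import Data.Fin as Fin

record Components {n : ℕ} (H : Graph n) : Set where
  field
    p     : ℕ
    comp  : Fin n → Fin p
    onto  : ∀ j → ∃ λ x → comp x ≡ j
    exact : ∀ x y → (comp x ≡ comp y) ⇔ Reachable H x y
open Components public

compSize : ∀ {n} {H : Graph n} (C : Components H) → Fin (p C) → ℕ
compSize C j = ∑ (λ x → indicator (comp C x ≟ j))
  where
  indicator : ∀ {A : Set} → Dec A → ℕ
  indicator (yes _) = 1
  indicator (no _)  = 0

N₃ : ∀ {n} {H : Graph n} → Components H → ℕ
N₃ C = ∑ λ i → ∑ λ j → ∑ λ k → term i j k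
  where
  ind : ∀ {A : Set} → Dec A → ℕ
  ind (yes _) = 1
  ind (no _)  = 0
  term : Fin (p C) → Fin (p C) → Fin (p C) → ℕ
  term i j k = ind (i Data.Fin.<? j) * ind (j Data.Fin.<? k)
               * (compSize C i * compSize C j * compSize C k)
    where import Data.Fin

-- Fix a block B. Each component of G ∖ B meets B in exactly one vertex, its gate: two such
-- vertices would be the ends of an ear of B, contradicting maximality. So a shortest path between
-- different components of G ∖ B passes through both gates, d(x,y) = d(x,gₓ) + 1 + d(g_y,y), and
-- three vertices in three different components have no median. Conversely, if {x,y,z} has no
-- median, let w lie on geodesics from x to y and from x to z with d(w,y) least; the block holding
-- the first edge of a geodesic from w to y separates x, y and z. Two blocks never separate the same
-- triple, so nm(G) counts, block by block, the triples x < y < z in three components of G ∖ B.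
-- Summing over the six orderings of each triple shows there are as many of these as triples whose
-- components are listed in increasing order, which is N₃(G ∖ B).

module Submission where

open import Defs hiding (sym)
open import Data.Bool as Bool using (true; false)
open import Data.Nat using (ℕ; zero; suc; _+_; _*_; _≤_; _<_; z≤n; s≤s)
import Data.Nat.Properties as ℕₚ
open import Data.Nat.Induction using (<-wellFounded)
open import Data.Nat.ListAction using (sum)
open import Data.Nat.ListAction.Properties using (sum-++)
open import Data.Nat.Tactic.RingSolver using (solve-∀)
open import Data.Fin as Fin using (Fin; _≟_; _<?_)
import Data.Fin.Properties as Finₚ
open import Data.Fin.Properties using (any?)
open import Data.Fin.Subset using (Subset; _∈_; _∉_; _⊆_; _⊃_; _∪_; _-_; ⁅_⁆)
import Data.Fin.Subset.Properties as Subsetₚ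
open import Data.Fin.Subset.Induction using (⊃-wellFounded)
open import Data.List using (List; []; _∷_; _++_; length; filter; map; tabulate; allFin; cartesianProduct)
import Data.List.Properties as Listₚ
open import Data.List.Relation.Unary.All as All using (All)
open import Data.List.Relation.Unary.All.Properties using (all-filter)
open import Data.List.Relation.Unary.Unique.Propositional using (Unique)
import Data.List.Relation.Unary.Unique.Propositional.Properties as Uniqueₚ
import Data.List.Membership.Propositional as Membership
open import Data.List.Membership.Propositional.Properties using (∈-filter⁺; ∈-cartesianProduct⁺; ∈-allFin)
open import Data.Vec as Vec using (lookup)
import Data.Vec.Properties as Vecₚ
open import Data.Product using (Σ; ∃; _×_; _,_; proj₁; proj₂)
open import Data.Sum using (_⊎_; inj₁; inj₂)
open import Data.Empty using (⊥; ⊥-elim)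
open import Function using (id; _∘_; _⇔_; mk⇔; Equivalence)
open import Induction.WellFounded using (Acc; acc)
open import Relation.Binary.Definitions using (tri<; tri≈; tri>)
open import Relation.Nullary using (¬_; Dec; yes; no)
open import Relation.Nullary.Decidable using (_×-dec_; ¬?)
open import Relation.Unary using (Decidable)
open import Relation.Binary.PropositionalEquality
  using (_≡_; _≢_; refl; sym; trans; cong; cong₂; subst; subst₂)

open ℕₚ.≤-Reasoning

-- Finite sums

𝟙 : ∀ {A : Set} → Dec A → ℕ
𝟙 (yes _) = 1
𝟙 (no _)  = 0

𝟙-× : ∀ {A B : Set} (a? : Dec A) (b? : Dec B) → 𝟙 (a? ×-dec b?) ≡ 𝟙 a? * 𝟙 b?
𝟙-× (yes _) (yes _) = refl
𝟙-× (yes _) (no _)  = refl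
𝟙-× (no _)  (yes _) = refl
𝟙-× (no _)  (no _)  = refl

∑-cong : ∀ {p} {f g : Fin p → ℕ} → (∀ i → f i ≡ g i) → ∑ f ≡ ∑ g
∑-cong {zero}  f≗g = refl
∑-cong {suc p} f≗g = cong₂ _+_ (f≗g Fin.zero) (∑-cong (f≗g ∘ Fin.suc))

∑-zero : ∀ {p} (f : Fin p → ℕ) → (∀ i → f i ≡ 0) → ∑ f ≡ 0
∑-zero {zero}  f f≗0 = refl
∑-zero {suc p} f f≗0 = cong₂ _+_ (f≗0 Fin.zero) (∑-zero (f ∘ Fin.suc) (f≗0 ∘ Fin.suc))

∑-+ : ∀ {p} (f g : Fin p → ℕ) → ∑ (λ i → f i + g i) ≡ ∑ f + ∑ g
∑-+ {zero}  f g = refl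
∑-+ {suc p} f g = begin-equality
  f₀ + g₀ + ∑ (λ i → f (Fin.suc i) + g (Fin.suc i))  ≡⟨ cong (f₀ + g₀ +_) (∑-+ (f ∘ Fin.suc) (g ∘ Fin.suc)) ⟩
  f₀ + g₀ + (∑ (f ∘ Fin.suc) + ∑ (g ∘ Fin.suc))      ≡⟨ interchange f₀ g₀ _ _ ⟩
  f₀ + ∑ (f ∘ Fin.suc) + (g₀ + ∑ (g ∘ Fin.suc))      ∎
  where
  f₀ g₀ : ℕ
  f₀ = f Fin.zero
  g₀ = g Fin.zero
  interchange : ∀ a b c d → a + b + (c + d) ≡ a + c + (b + d)
  interchange = solve-∀

∑-distribˡ : ∀ {p} a (f : Fin p → ℕ) → a * ∑ f ≡ ∑ (λ i → a * f i)
∑-distribˡ {zero}  a f = ℕₚ.*-zeroʳ a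
∑-distribˡ {suc p} a f =
  trans (ℕₚ.*-distribˡ-+ a (f Fin.zero) _) (cong (a * f Fin.zero +_) (∑-distribˡ a (f ∘ Fin.suc)))

∑-distribʳ : ∀ {p} a (f : Fin p → ℕ) → ∑ f * a ≡ ∑ (λ i → f i * a)
∑-distribʳ a f = trans (ℕₚ.*-comm (∑ f) a) (trans (∑-distribˡ a f) (∑-cong λ i → ℕₚ.*-comm a (f i)))

∑-comm : ∀ {p q} (f : Fin p → Fin q → ℕ) → ∑ (λ i → ∑ λ j → f i j) ≡ ∑ (λ j → ∑ λ i → f i j)
∑-comm {zero} {q} f = sym (∑-zero {q} _ λ _ → refl)
∑-comm {suc p} f = begin-equality
  ∑ (f Fin.zero) + ∑ (λ i → ∑ λ j → f (Fin.suc i) j)  ≡⟨ cong (∑ (f Fin.zero) +_) (∑-comm (f ∘ Fin.suc)) ⟩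
  ∑ (f Fin.zero) + ∑ (λ j → ∑ λ i → f (Fin.suc i) j)  ≡⟨ ∑-+ (f Fin.zero) _ ⟨
  ∑ (λ j → f Fin.zero j + ∑ λ i → f (Fin.suc i) j)    ∎

∑-single : ∀ {p} (i : Fin p) (f : Fin p → ℕ) → (∀ j → j ≢ i → f j ≡ 0) → ∑ f ≡ f i
∑-single {suc p} Fin.zero f vanish =
  trans (cong (f Fin.zero +_) (∑-zero _ λ j → vanish (Fin.suc j) λ ())) (ℕₚ.+-identityʳ _)
∑-single {suc p} (Fin.suc i) f vanish =
  trans (cong (_+ ∑ (f ∘ Fin.suc)) (vanish Fin.zero λ ()))
        (∑-single i (f ∘ Fin.suc) λ j j≢i → vanish (Fin.suc j) (j≢i ∘ Finₚ.suc-injective))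

∑-select : ∀ {p} (a : Fin p) (f : Fin p → ℕ) → ∑ (λ i → 𝟙 (a ≟ i) * f i) ≡ f a
∑-select a f = trans (∑-single a _ vanish) (selected (a ≟ a))
  where
  vanish : ∀ j → j ≢ a → 𝟙 (a ≟ j) * f j ≡ 0
  vanish j j≢a with a ≟ j
  ... | yes a≡j = ⊥-elim (j≢a (sym a≡j))
  ... | no _    = refl
  selected : (a≟a : Dec (a ≡ a)) → 𝟙 a≟a * f a ≡ f a
  selected (yes _)  = ℕₚ.+-identityʳ (f a)
  selected (no a≢a) = ⊥-elim (a≢a refl)

𝟙-any? : ∀ {p} {Q : Fin p → Set} (Q? : Decidable Q) → (∀ i j → Q i → Q j → i ≡ j) →
         𝟙 (any? Q?) ≡ ∑ (λ i → 𝟙 (Q? i))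
𝟙-any? {Q = Q} Q? unique with any? Q?
... | yes (i , qi) = sym (trans (∑-single i _ vanish) (holds (Q? i)))
  where
  vanish : ∀ j → j ≢ i → 𝟙 (Q? j) ≡ 0
  vanish j j≢i with Q? j
  ... | yes qj = ⊥-elim (j≢i (unique j i qj qi))
  ... | no _   = refl
  holds : (qi? : Dec (Q i)) → 𝟙 qi? ≡ 1
  holds (yes _)  = refl
  holds (no ¬qi) = ⊥-elim (¬qi qi)
... | no none = sym (∑-zero _ fails)
  where
  fails : ∀ i → 𝟙 (Q? i) ≡ 0
  fails i with Q? i
  ... | yes qi = ⊥-elim (none (i , qi))
  ... | no _   = refl

-- Counting triples

∑³ : ∀ {m} → (Fin m → Fin m → Fin m → ℕ) → ℕ
∑³ F = ∑ λ x → ∑ λ y → ∑ λ z → F x y z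

∑³-∑-comm : ∀ {m p} (F : Fin p → Fin m → Fin m → Fin m → ℕ) →
  ∑³ (λ x y z → ∑ λ i → F i x y z) ≡ ∑ (λ i → ∑³ (F i))
∑³-∑-comm F = begin-equality
  ∑³ (λ x y z → ∑ λ i → F i x y z)               ≡⟨ ∑-cong (λ x → ∑-cong λ y → ∑-comm λ z i → F i x y z) ⟩
  ∑ (λ x → ∑ λ y → ∑ λ i → ∑ λ z → F i x y z)    ≡⟨ ∑-cong (λ x → ∑-comm λ y i → ∑ (F i x y)) ⟩
  ∑ (λ x → ∑ λ i → ∑ λ y → ∑ λ z → F i x y z)    ≡⟨ ∑-comm (λ x i → ∑ λ y → ∑ (F i x y)) ⟩
  ∑ (λ i → ∑³ (F i))                              ∎

module _ {m : ℕ} where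

  ∑³-cong : {F G : Fin m → Fin m → Fin m → ℕ} → (∀ x y z → F x y z ≡ G x y z) → ∑³ F ≡ ∑³ G
  ∑³-cong F≗G = ∑-cong λ x → ∑-cong λ y → ∑-cong λ z → F≗G x y z

  ∑³-+ : (F G : Fin m → Fin m → Fin m → ℕ) → ∑³ (λ x y z → F x y z + G x y z) ≡ ∑³ F + ∑³ G
  ∑³-+ F G = begin-equality
    ∑³ (λ x y z → F x y z + G x y z)
      ≡⟨ ∑-cong (λ x → ∑-cong λ y → ∑-+ (F x y) (G x y)) ⟩
    ∑ (λ x → ∑ λ y → ∑ (F x y) + ∑ (G x y))
      ≡⟨ ∑-cong (λ x → ∑-+ (λ y → ∑ (F x y)) (λ y → ∑ (G x y))) ⟩
    ∑ (λ x → ∑ (λ y → ∑ (F x y)) + ∑ (λ y → ∑ (G x y)))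
      ≡⟨ ∑-+ (λ x → ∑ λ y → ∑ (F x y)) (λ x → ∑ λ y → ∑ (G x y)) ⟩
    ∑³ F + ∑³ G ∎

  ∑³-swap₁₂ : (F : Fin m → Fin m → Fin m → ℕ) → ∑³ F ≡ ∑³ (λ x y z → F y x z)
  ∑³-swap₁₂ F = ∑-comm λ x y → ∑ (F x y)

  ∑³-swap₂₃ : (F : Fin m → Fin m → Fin m → ℕ) → ∑³ F ≡ ∑³ (λ x y z → F x z y)
  ∑³-swap₂₃ F = ∑-cong λ x → ∑-comm (F x)

  ∑³-rotate : (F : Fin m → Fin m → Fin m → ℕ) → ∑³ F ≡ ∑³ (λ x y z → F z x y)
  ∑³-rotate F = trans (∑³-swap₁₂ F) (∑³-swap₂₃ λ x y z → F y x z)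

  ∑³-transpose-weight : (A B : Fin m → Fin m → Fin m → ℕ) →
    ∑³ (λ x y z → A x y z * (B x y z + B x z y)) ≡ ∑³ (λ x y z → (A x y z + A x z y) * B x y z)
  ∑³-transpose-weight A B = begin-equality
    ∑³ (λ x y z → A x y z * (B x y z + B x z y))
      ≡⟨ ∑³-cong (λ x y z → ℕₚ.*-distribˡ-+ (A x y z) (B x y z) (B x z y)) ⟩
    ∑³ (λ x y z → A x y z * B x y z + A x y z * B x z y)
      ≡⟨ ∑³-+ _ _ ⟩
    ∑³ (λ x y z → A x y z * B x y z) + ∑³ (λ x y z → A x y z * B x z y)
      ≡⟨ cong (∑³ (λ x y z → A x y z * B x y z) +_) (∑³-swap₂₃ λ x y z → A x y z * B x z y) ⟩
    ∑³ (λ x y z → A x y z * B x y z) + ∑³ (λ x y z → A x z y * B x y z)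
      ≡⟨ ∑³-+ _ _ ⟨
    ∑³ (λ x y z → A x y z * B x y z + A x z y * B x y z)
      ≡⟨ ∑³-cong (λ x y z → ℕₚ.*-distribʳ-+ (B x y z) (A x y z) (A x z y)) ⟨
    ∑³ (λ x y z → (A x y z + A x z y) * B x y z) ∎

  ∑³-rotate-weight : (A B : Fin m → Fin m → Fin m → ℕ) →
    ∑³ (λ x y z → A x y z * (B x y z + B y z x + B z x y)) ≡
    ∑³ (λ x y z → (A x y z + A y z x + A z x y) * B x y z)
  ∑³-rotate-weight A B = begin-equality
    ∑³ (λ x y z → A x y z * (B x y z + B y z x + B z x y))
      ≡⟨ ∑³-cong (λ x y z → expand (A x y z) (B x y z) (B y z x) (B z x y)) ⟩
    ∑³ (λ x y z → A x y z * B x y z + A x y z * B y z x + A x y z * B z x y)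
      ≡⟨ ∑³-+ _ _ ⟩
    ∑³ (λ x y z → A x y z * B x y z + A x y z * B y z x) + ∑³ (λ x y z → A x y z * B z x y)
      ≡⟨ cong₂ _+_ (∑³-+ _ _) (trans (∑³-rotate λ x y z → A x y z * B z x y) (∑³-rotate λ x y z → A z x y * B y z x)) ⟩
    ∑³ (λ x y z → A x y z * B x y z) + ∑³ (λ x y z → A x y z * B y z x) + ∑³ (λ x y z → A y z x * B x y z)
      ≡⟨ cong (λ s → ∑³ (λ x y z → A x y z * B x y z) + s + ∑³ (λ x y z → A y z x * B x y z))
              (∑³-rotate λ x y z → A x y z * B y z x) ⟩
    ∑³ (λ x y z → A x y z * B x y z) + ∑³ (λ x y z → A z x y * B x y z) + ∑³ (λ x y z → A y z x * B x y z)
      ≡⟨ cong (_+ ∑³ (λ x y z → A y z x * B x y z)) (∑³-+ _ _) ⟨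
    ∑³ (λ x y z → A x y z * B x y z + A z x y * B x y z) + ∑³ (λ x y z → A y z x * B x y z)
      ≡⟨ ∑³-+ _ _ ⟨
    ∑³ (λ x y z → A x y z * B x y z + A z x y * B x y z + A y z x * B x y z)
      ≡⟨ ∑³-cong (λ x y z → collect (B x y z) (A x y z) (A y z x) (A z x y)) ⟩
    ∑³ (λ x y z → (A x y z + A y z x + A z x y) * B x y z) ∎
    where
    expand : ∀ a b c d → a * (b + c + d) ≡ a * b + a * c + a * d
    expand = solve-∀
    collect : ∀ b a c d → a * b + d * b + c * b ≡ (a + c + d) * b
    collect = solve-∀

  symmetrise : (Fin m → Fin m → Fin m → ℕ) → Fin m → Fin m → Fin m → ℕ
  symmetrise F x y z = (F x y z + F x z y) + (F y z x + F y x z) + (F z x y + F z y x)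

  -- Each permutation of three arguments is a rotation, possibly followed by a swap of the last two.
  ∑³-symmetrise : (A B : Fin m → Fin m → Fin m → ℕ) →
    ∑³ (λ x y z → A x y z * symmetrise B x y z) ≡ ∑³ (λ x y z → symmetrise A x y z * B x y z)
  ∑³-symmetrise A B = begin-equality
    ∑³ (λ x y z → A x y z * symmetrise B x y z)
      ≡⟨ ∑³-rotate-weight A (λ x y z → B x y z + B x z y) ⟩
    ∑³ (λ x y z → A′ x y z * (B x y z + B x z y))
      ≡⟨ ∑³-transpose-weight A′ B ⟩
    ∑³ (λ x y z → (A′ x y z + A′ x z y) * B x y z)
      ≡⟨ ∑³-cong (λ x y z → cong (_* B x y z)
           (reorder (A x y z) (A x z y) (A y z x) (A y x z) (A z x y) (A z y x))) ⟩
    ∑³ (λ x y z → symmetrise A x y z * B x y z) ∎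
    where
    A′ : Fin m → Fin m → Fin m → ℕ
    A′ x y z = A x y z + A y z x + A z x y
    reorder : ∀ a b c d e f → a + c + e + (b + f + d) ≡ a + b + (c + d) + (e + f)
    reorder = solve-∀

  ascending : Fin m → Fin m → Fin m → ℕ
  ascending a b c = 𝟙 (a <? b) * 𝟙 (b <? c)

  AllDistinct : Fin m → Fin m → Fin m → Set
  AllDistinct a b c = a ≢ b × a ≢ c × b ≢ c

  allDistinct? : ∀ a b c → Dec (AllDistinct a b c)
  allDistinct? a b c = ¬? (a ≟ b) ×-dec (¬? (a ≟ c) ×-dec ¬? (b ≟ c))

  distinct : Fin m → Fin m → Fin m → ℕ
  distinct a b c = 𝟙 (allDistinct? a b c)

  distinct≡1 : ∀ {a b c} → AllDistinct a b c → distinct a b c ≡ 1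
  distinct≡1 {a} {b} {c} abc with allDistinct? a b c
  ... | yes _    = refl
  ... | no ¬abc = ⊥-elim (¬abc abc)

  data Order (a b : Fin m) : Set where
    below : a Fin.< b → Order a b
    equal : a ≡ b → Order a b
    above : b Fin.< a → Order a b

  module _ {a b : Fin m} where

    [<] [>] [≢] : Order a b → ℕ
    [<] (below _) = 1
    [<] (equal _) = 0
    [<] (above _) = 0
    [>] (below _) = 0
    [>] (equal _) = 0
    [>] (above _) = 1
    [≢] (below _) = 1
    [≢] (equal _) = 0
    [≢] (above _) = 1

    𝟙-<? : (o : Order a b) → 𝟙 (a <? b) ≡ [<] o
    𝟙-<? o with a <? b
    𝟙-<? (below _)   | yes _   = refl
    𝟙-<? (below a<b) | no a≮b  = ⊥-elim (a≮b a<b)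
    𝟙-<? (equal a≡b) | yes a<b = ⊥-elim (Finₚ.<-irrefl a≡b a<b)
    𝟙-<? (equal _)   | no _    = refl
    𝟙-<? (above b<a) | yes a<b = ⊥-elim (Finₚ.<-asym a<b b<a)
    𝟙-<? (above _)   | no _    = refl

    𝟙->? : (o : Order a b) → 𝟙 (b <? a) ≡ [>] o
    𝟙->? o with b <? a
    𝟙->? (above _)   | yes _   = refl
    𝟙->? (above b<a) | no b≮a  = ⊥-elim (b≮a b<a)
    𝟙->? (equal a≡b) | yes b<a = ⊥-elim (Finₚ.<-irrefl (sym a≡b) b<a)
    𝟙->? (equal _)   | no _    = refl
    𝟙->? (below a<b) | yes b<a = ⊥-elim (Finₚ.<-asym a<b b<a)
    𝟙->? (below _)   | no _    = refl

    𝟙-≢? : (o : Order a b) → 𝟙 (¬? (a ≟ b)) ≡ [≢] o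
    𝟙-≢? o with a ≟ b
    𝟙-≢? (below a<b) | yes a≡b = ⊥-elim (Finₚ.<-irrefl a≡b a<b)
    𝟙-≢? (equal _)   | yes _   = refl
    𝟙-≢? (above b<a) | yes a≡b = ⊥-elim (Finₚ.<-irrefl (sym a≡b) b<a)
    𝟙-≢? (below _)   | no _    = refl
    𝟙-≢? (equal a≡b) | no a≢b  = ⊥-elim (a≢b a≡b)
    𝟙-≢? (above _)   | no _    = refl

  -- Reduces the claim to arithmetic on the three pairwise orders, settled by refl in each case.
  symmetrise-ascending-by : ∀ {a b c} (ab : Order a b) (bc : Order b c) (ac : Order a c) →
    ([<] ab * [<] bc + [<] ac * [>] bc) + ([<] bc * [>] ac + [>] ab * [<] ac) + ([>] ac * [<] ab + [>] bc * [>] ab)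
      ≡ [≢] ab * ([≢] ac * [≢] bc) →
    symmetrise ascending a b c ≡ distinct a b c
  symmetrise-ascending-by {a} {b} {c} ab bc ac counted
    rewrite 𝟙-× (¬? (a ≟ b)) (¬? (a ≟ c) ×-dec ¬? (b ≟ c)) | 𝟙-× (¬? (a ≟ c)) (¬? (b ≟ c))
          | 𝟙-<? ab | 𝟙->? ab | 𝟙-≢? ab | 𝟙-<? bc | 𝟙->? bc | 𝟙-≢? bc | 𝟙-<? ac | 𝟙->? ac | 𝟙-≢? ac
          = counted

  symmetrise-ascending : ∀ a b c → symmetrise ascending a b c ≡ distinct a b c
  symmetrise-ascending a b c with Finₚ.<-cmp a b | Finₚ.<-cmp b c
  ... | tri< a<b _ _ | tri< b<c _ _ = symmetrise-ascending-by (below a<b) (below b<c) (below (Finₚ.<-trans a<b b<c)) refl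
  ... | tri< a<b _ _ | tri≈ _ b≡c _ = symmetrise-ascending-by (below a<b) (equal b≡c) (below (subst (a Fin.<_) b≡c a<b)) refl
  ... | tri< a<b _ _ | tri> _ _ c<b with Finₚ.<-cmp a c
  ...   | tri< a<c _ _ = symmetrise-ascending-by (below a<b) (above c<b) (below a<c) refl
  ...   | tri≈ _ a≡c _ = symmetrise-ascending-by (below a<b) (above c<b) (equal a≡c) refl
  ...   | tri> _ _ c<a = symmetrise-ascending-by (below a<b) (above c<b) (above c<a) refl
  symmetrise-ascending a b c | tri≈ _ a≡b _ | tri< b<c _ _ =
    symmetrise-ascending-by (equal a≡b) (below b<c) (below (subst (Fin._< c) (sym a≡b) b<c)) refl
  symmetrise-ascending a b c | tri≈ _ a≡b _ | tri≈ _ b≡c _ =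
    symmetrise-ascending-by (equal a≡b) (equal b≡c) (equal (trans a≡b b≡c)) refl
  symmetrise-ascending a b c | tri≈ _ a≡b _ | tri> _ _ c<b =
    symmetrise-ascending-by (equal a≡b) (above c<b) (above (subst (c Fin.<_) (sym a≡b) c<b)) refl
  symmetrise-ascending a b c | tri> _ _ b<a | tri< b<c _ _ with Finₚ.<-cmp a c
  ...   | tri< a<c _ _ = symmetrise-ascending-by (above b<a) (below b<c) (below a<c) refl
  ...   | tri≈ _ a≡c _ = symmetrise-ascending-by (above b<a) (below b<c) (equal a≡c) refl
  ...   | tri> _ _ c<a = symmetrise-ascending-by (above b<a) (below b<c) (above c<a) refl
  symmetrise-ascending a b c | tri> _ _ b<a | tri≈ _ b≡c _ =
    symmetrise-ascending-by (above b<a) (equal b≡c) (above (subst (Fin._< a) b≡c b<a)) refl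
  symmetrise-ascending a b c | tri> _ _ b<a | tri> _ _ c<b =
    symmetrise-ascending-by (above b<a) (above c<b) (above (Finₚ.<-trans c<b b<a)) refl

module _ {n p : ℕ} (c : Fin n → Fin p) where

  fibreSize : Fin p → ℕ
  fibreSize j = ∑ λ x → 𝟙 (c x ≟ j)

  ∑-fibres : (g : Fin p → ℕ) → ∑ (λ j → fibreSize j * g j) ≡ ∑ (λ x → g (c x))
  ∑-fibres g = begin-equality
    ∑ (λ j → fibreSize j * g j)                ≡⟨ ∑-cong (λ j → ∑-distribʳ (g j) λ x → 𝟙 (c x ≟ j)) ⟩
    ∑ (λ j → ∑ λ x → 𝟙 (c x ≟ j) * g j)        ≡⟨ ∑-comm (λ j x → 𝟙 (c x ≟ j) * g j) ⟩
    ∑ (λ x → ∑ λ j → 𝟙 (c x ≟ j) * g j)        ≡⟨ ∑-cong (λ x → ∑-select (c x) g) ⟩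
    ∑ (λ x → g (c x))                          ∎

  ∑-ascending-fibres :
    ∑ (λ i → ∑ λ j → ∑ λ k → ascending i j k * (fibreSize i * fibreSize j * fibreSize k)) ≡
    ∑³ (λ x y z → ascending (c x) (c y) (c z))
  ∑-ascending-fibres = begin-equality
    ∑ (λ i → ∑ λ j → ∑ λ k → ascending i j k * (s i * s j * s k))
      ≡⟨ ∑-cong (λ i → ∑-cong λ j → ∑-cong λ k → rearrange (ascending i j k) (s i) (s j) (s k)) ⟩
    ∑ (λ i → ∑ λ j → ∑ λ k → s i * (s j * (s k * ascending i j k)))
      ≡⟨ ∑-cong (λ i → ∑-cong λ j → trans (cong (s i *_) (∑-distribˡ (s j) λ k → s k * ascending i j k))
                                               (∑-distribˡ (s i) λ k → s j * (s k * ascending i j k))) ⟨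
    ∑ (λ i → ∑ λ j → s i * (s j * ∑ λ k → s k * ascending i j k))
      ≡⟨ ∑-cong (λ i → ∑-cong λ j → cong (λ t → s i * (s j * t)) (∑-fibres (ascending i j))) ⟩
    ∑ (λ i → ∑ λ j → s i * (s j * ∑ λ z → ascending i j (c z)))
      ≡⟨ ∑-cong (λ i → ∑-distribˡ (s i) λ j → s j * ∑ λ z → ascending i j (c z)) ⟨
    ∑ (λ i → s i * ∑ λ j → s j * ∑ λ z → ascending i j (c z))
      ≡⟨ ∑-cong (λ i → cong (s i *_) (∑-fibres λ j → ∑ λ z → ascending i j (c z))) ⟩
    ∑ (λ i → s i * ∑ λ y → ∑ λ z → ascending i (c y) (c z))
      ≡⟨ ∑-fibres (λ i → ∑ λ y → ∑ λ z → ascending i (c y) (c z)) ⟩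
    ∑³ (λ x y z → ascending (c x) (c y) (c z)) ∎
    where
    s : Fin p → ℕ
    s = fibreSize
    rearrange : ∀ o a b c → o * (a * b * c) ≡ a * (b * (c * o))
    rearrange = solve-∀

  ascending-colours⇒distinct : ∀ x y z →
    ascending (c x) (c y) (c z) ≡ ascending (c x) (c y) (c z) * distinct x y z
  ascending-colours⇒distinct x y z with c x <? c y | c y <? c z
  ... | no _       | _          = refl
  ... | yes _      | no _       = refl
  ... | yes cx<cy  | yes cy<cz  = sym (trans (ℕₚ.+-identityʳ _) (distinct≡1 (x≢y , x≢z , y≢z)))
    where
    x≢y : x ≢ y
    x≢y refl = Finₚ.<-irrefl refl cx<cy
    x≢z : x ≢ z
    x≢z refl = Finₚ.<-irrefl refl (Finₚ.<-trans cx<cy cy<cz)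
    y≢z : y ≢ z
    y≢z refl = Finₚ.<-irrefl refl cy<cz

  ∑-ascending-colours : ∑³ (λ x y z → ascending (c x) (c y) (c z)) ≡
                        ∑³ (λ x y z → distinct (c x) (c y) (c z) * ascending x y z)
  ∑-ascending-colours = begin-equality
    ∑³ (λ x y z → ascending (c x) (c y) (c z))
      ≡⟨ ∑³-cong ascending-colours⇒distinct ⟩
    ∑³ (λ x y z → ascending (c x) (c y) (c z) * distinct x y z)
      ≡⟨ ∑³-cong (λ x y z → cong (ascending (c x) (c y) (c z) *_) (symmetrise-ascending x y z)) ⟨
    ∑³ (λ x y z → ascending (c x) (c y) (c z) * symmetrise ascending x y z)
      ≡⟨ ∑³-symmetrise (λ x y z → ascending (c x) (c y) (c z)) ascending ⟩
    ∑³ (λ x y z → symmetrise ascending (c x) (c y) (c z) * ascending x y z)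
      ≡⟨ ∑³-cong (λ x y z → cong (_* ascending x y z) (symmetrise-ascending (c x) (c y) (c z))) ⟩
    ∑³ (λ x y z → distinct (c x) (c y) (c z) * ascending x y z) ∎

-- The indicator used in Defs lives in a where block and cannot be named, so
-- the left-hand sides of the two pointwise lemmas are left to unification.
mutual
  compSize≡fibreSize : ∀ {n} {H : Graph n} (C : Components H) j → compSize C j ≡ fibreSize (comp C) j
  compSize≡fibreSize C j = ∑-cong (compSize-term C j)

  compSize-term : ∀ {n} {H : Graph n} (C : Components H) j x → _ ≡ 𝟙 (comp C x ≟ j)
  compSize-term C j x with comp C x ≟ j
  ... | yes _ = refl
  ... | no _  = refl

mutual
  N₃≡∑-fibres : ∀ {n} {H : Graph n} (C : Components H) →
    N₃ C ≡ ∑ λ i → ∑ λ j → ∑ λ k →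
             ascending i j k * (fibreSize (comp C) i * fibreSize (comp C) j * fibreSize (comp C) k)
  N₃≡∑-fibres C = ∑-cong λ i → ∑-cong λ j → ∑-cong λ k → N₃-term C i j k

  N₃-term : ∀ {n} {H : Graph n} (C : Components H) i j k →
    _ ≡ ascending i j k * (fibreSize (comp C) i * fibreSize (comp C) j * fibreSize (comp C) k)
  N₃-term C i j k with i <? j | j <? k
  ... | yes _ | yes _ rewrite compSize≡fibreSize C i | compSize≡fibreSize C j | compSize≡fibreSize C k = refl
  ... | yes _ | no _  = refl
  ... | no _  | _     = refl

N₃-triples : ∀ {n} {H : Graph n} (C : Components H) →
  N₃ C ≡ ∑³ (λ x y z → distinct (comp C x) (comp C y) (comp C z) * ascending x y z)
N₃-triples C = trans (N₃≡∑-fibres C) (trans (∑-ascending-fibres (comp C)) (∑-ascending-colours (comp C)))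

module _ {A : Set} {Q : A → Set} (Q? : Decidable Q) where

  length-filter : ∀ xs → length (filter Q? xs) ≡ sum (map (λ a → 𝟙 (Q? a)) xs)
  length-filter [] = refl
  length-filter (x ∷ xs) with Q? x
  ... | yes _ = cong suc (length-filter xs)
  ... | no _  = length-filter xs

sum-cartesianProduct : ∀ {A B : Set} (f : A × B → ℕ) xs ys →
  sum (map f (cartesianProduct xs ys)) ≡ sum (map (λ x → sum (map (λ y → f (x , y)) ys)) xs)
sum-cartesianProduct f []       ys = refl
sum-cartesianProduct f (x ∷ xs) ys = begin-equality
  sum (map f (map (x ,_) ys ++ cartesianProduct xs ys))
    ≡⟨ cong sum (Listₚ.map-++ f (map (x ,_) ys) (cartesianProduct xs ys)) ⟩
  sum (map f (map (x ,_) ys) ++ map f (cartesianProduct xs ys))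
    ≡⟨ sum-++ (map f (map (x ,_) ys)) (map f (cartesianProduct xs ys)) ⟩
  sum (map f (map (x ,_) ys)) + sum (map f (cartesianProduct xs ys))
    ≡⟨ cong₂ _+_ (cong sum (sym (Listₚ.map-∘ ys))) (sum-cartesianProduct f xs ys) ⟩
  sum (map (λ y → f (x , y)) ys) + sum (map (λ x → sum (map (λ y → f (x , y)) ys)) xs) ∎

sum-tabulate : ∀ {m} {A : Set} (h : Fin m → A) (f : A → ℕ) → sum (map f (tabulate h)) ≡ ∑ (f ∘ h)
sum-tabulate {zero}  h f = refl
sum-tabulate {suc m} h f = cong (f (h Fin.zero) +_) (sum-tabulate (h ∘ Fin.suc) f)

module _ {n : ℕ} where

  triples : List (Fin n × Fin n × Fin n)
  triples = cartesianProduct (allFin n) (cartesianProduct (allFin n) (allFin n))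

  sum-triples : (f : Fin n × Fin n × Fin n → ℕ) → sum (map f triples) ≡ ∑³ (λ x y z → f (x , y , z))
  sum-triples f = begin-equality
    sum (map f triples)
      ≡⟨ sum-cartesianProduct f (allFin n) _ ⟩
    sum (map (λ x → sum (map (λ yz → f (x , yz)) (cartesianProduct (allFin n) (allFin n)))) (allFin n))
      ≡⟨ cong sum (Listₚ.map-cong (λ x → sum-cartesianProduct (λ yz → f (x , yz)) (allFin n) (allFin n)) (allFin n)) ⟩
    sum (map (λ x → sum (map (λ y → sum (map (λ z → f (x , y , z)) (allFin n))) (allFin n))) (allFin n))
      ≡⟨ sum-tabulate {n} id _ ⟩
    ∑ (λ x → sum (map (λ y → sum (map (λ z → f (x , y , z)) (allFin n))) (allFin n)))
      ≡⟨ ∑-cong (λ x → trans (sum-tabulate {n} id λ y → sum (map (λ z → f (x , y , z)) (allFin n)))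
                             (∑-cong λ y → sum-tabulate {n} id λ z → f (x , y , z))) ⟩
    ∑³ (λ x y z → f (x , y , z)) ∎

  count-decidable : ∀ {P Q : Fin n × Fin n × Fin n → Set} (Q? : Decidable Q) → (∀ t → P t ⇔ Q t) →
                    Count P (∑³ λ x y z → 𝟙 (Q? (x , y , z)))
  count-decidable {P} Q? P⇔Q =
    filter Q? triples , unique , All.map (Equivalence.from (P⇔Q _)) (all-filter Q? triples) , complete ,
    trans (length-filter Q? triples) (sum-triples λ t → 𝟙 (Q? t))
    where
    unique : Unique (filter Q? triples)
    unique = Uniqueₚ.filter⁺ Q? (Uniqueₚ.cartesianProduct⁺ (Uniqueₚ.allFin⁺ n)
                                  (Uniqueₚ.cartesianProduct⁺ (Uniqueₚ.allFin⁺ n) (Uniqueₚ.allFin⁺ n)))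
    complete : ∀ t → P t → t Membership.∈ filter Q? triples
    complete (x , y , z) pt = ∈-filter⁺ Q? (∈-cartesianProduct⁺ (∈-allFin x)
                                (∈-cartesianProduct⁺ (∈-allFin y) (∈-allFin z))) (Equivalence.to (P⇔Q _) pt)

-- Walks

module _ {n : ℕ} {G : Graph n} where

  edge-sym : ∀ {u v} → E G u v ≡ true → E G v u ≡ true
  edge-sym {u} {v} uv = trans (Graph.sym G v u) uv

  no-loop : ∀ {u} → E G u u ≢ true
  no-loop {u} e with trans (sym e) (Graph.irrefl G u)
  ... | ()

  infixr 5 _++ʷ_
  _++ʷ_ : ∀ {u v w k l} → Walk G u v k → Walk G v w l → Walk G u w (k + l)
  here     ++ʷ q = q
  step e p ++ʷ q = step e (p ++ʷ q)

  reverseʷ : ∀ {u v k} → Walk G u v k → Walk G v u k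
  reverseʷ here                = here
  reverseʷ {k = suc k} (step e p) = subst (Walk G _ _) (ℕₚ.+-comm k 1) (reverseʷ p ++ʷ step (edge-sym e) here)

  walk-zero : ∀ {u v} → Walk G u v 0 → u ≡ v
  walk-zero here = refl

  onWalk-start : ∀ {u v k} (p : Walk G u v k) → OnWalk u p
  onWalk-start p = at-start p refl

  onWalk-end : ∀ {u v k} (p : Walk G u v k) → OnWalk v p
  onWalk-end here       = at-start here refl
  onWalk-end (step e p) = later e p (onWalk-end p)

  onWalk-junction : ∀ {u x v k l} (p : Walk G u x k) (q : Walk G x v l) → OnWalk x (p ++ʷ q)
  onWalk-junction here       q = onWalk-start q
  onWalk-junction (step e p) q = later e _ (onWalk-junction p q)

  onWalk? : ∀ x {u v k} (p : Walk G u v k) → Dec (OnWalk x p)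
  onWalk? x {u} p with x ≟ u
  onWalk? x p          | yes x≡u = yes (at-start p x≡u)
  onWalk? x here       | no x≢u = no λ { (at-start _ x≡u) → x≢u x≡u }
  onWalk? x (step e p) | no x≢u with onWalk? x p
  ... | yes on = yes (later e p on)
  ... | no off = no λ { (at-start _ x≡u) → x≢u x≡u ; (later _ _ on) → off on }

  record SplitAt {u v k} (x : Fin n) (p : Walk G u v k) : Set where
    field
      {k₁ k₂}  : ℕ
      prefix   : Walk G u x k₁
      suffix   : Walk G x v k₂
      lengths  : k₁ + k₂ ≡ k
      prefix⊆  : ∀ {y} → OnWalk y prefix → OnWalk y p
      suffix⊆  : ∀ {y} → OnWalk y suffix → OnWalk y p

  splitAt : ∀ {x u v k} (p : Walk G u v k) → OnWalk x p → SplitAt x p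
  splitAt p (at-start _ refl) = record
    { prefix = here ; suffix = p ; lengths = refl
    ; prefix⊆ = λ { (at-start _ refl) → onWalk-start p } ; suffix⊆ = λ on → on }
  splitAt (step e p) (later e p on) = record
    { prefix = step e prefix ; suffix = suffix ; lengths = cong suc lengths
    ; prefix⊆ = λ { (at-start _ refl) → onWalk-start _ ; (later _ _ on′) → later e p (prefix⊆ on′) }
    ; suffix⊆ = later e p ∘ suffix⊆ }
    where open SplitAt (splitAt p on)

  shortcut : ∀ {a x b v k l} (p : Walk G a x k) (q : Walk G x b l) → v ≢ x → OnWalk v p → OnWalk v q →
             ∃ λ m → m < k + l × Walk G a b m
  shortcut {k = k} {l} p q v≢x v∈p v∈q = _ , shorter , P.prefix ++ʷ Q.suffix
    where
    module P = SplitAt (splitAt p v∈p)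
    module Q = SplitAt (splitAt q v∈q)
    P-tail>0 : P.k₂ ≢ 0
    P-tail>0 k₂≡0 = v≢x (walk-zero (subst (Walk G _ _) k₂≡0 P.suffix))
    shorter : P.k₁ + Q.k₂ < k + l
    shorter = subst₂ _<_ refl (cong₂ _+_ P.lengths Q.lengths)
                (ℕₚ.+-mono-<-≤ (ℕₚ.m<m+n P.k₁ (ℕₚ.n≢0⇒n>0 P-tail>0)) (ℕₚ.m≤n+m Q.k₂ Q.k₁))

  mapWalk : ∀ {H : Graph n} (P : Fin n → Set) → (∀ {a b} → P a → P b → E G a b ≡ true → E H a b ≡ true) →
            ∀ {u v k} (p : Walk G u v k) → (∀ {x} → OnWalk x p → P x) → Walk H u v k
  mapWalk P keep here       inP = here
  mapWalk P keep (step e p) inP =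
    step (keep (inP (onWalk-start _)) (inP (later e p (onWalk-start p))) e) (mapWalk P keep p (inP ∘ later e p))

  vertices : ∀ {u v k} → Walk G u v k → Subset n
  vertices {u} here       = ⁅ u ⁆
  vertices {u} (step e p) = ⁅ u ⁆ ∪ vertices p

  ∈-vertices⁺ : ∀ {x u v k} {p : Walk G u v k} → OnWalk x p → x ∈ vertices p
  ∈-vertices⁺ {p = here}     (at-start _ refl) = Subsetₚ.x∈⁅x⁆ _
  ∈-vertices⁺ {p = step e p} (at-start _ refl) = Subsetₚ.x∈p∪q⁺ (inj₁ (Subsetₚ.x∈⁅x⁆ _))
  ∈-vertices⁺ {p = step e p} (later _ _ on)    = Subsetₚ.x∈p∪q⁺ (inj₂ (∈-vertices⁺ on))

  ∈-vertices⁻ : ∀ {x u v k} (p : Walk G u v k) → x ∈ vertices p → OnWalk x p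
  ∈-vertices⁻ here       x∈ = at-start here (Subsetₚ.x∈⁅y⁆⇒x≡y _ x∈)
  ∈-vertices⁻ (step e p) x∈ with Subsetₚ.x∈p∪q⁻ ⁅ _ ⁆ (vertices p) x∈
  ... | inj₁ x∈⁅u⁆ = at-start _ (Subsetₚ.x∈⁅y⁆⇒x≡y _ x∈⁅u⁆)
  ... | inj₂ x∈p   = later e p (∈-vertices⁻ p x∈p)

walk? : ∀ {n} (G : Graph n) u v k → Dec (Walk G u v k)
walk? G u v zero with u ≟ v
... | yes refl = yes here
... | no u≢v   = no λ { here → u≢v refl }
walk? G u v (suc k) with any? (λ w → (E G u w Bool.≟ true) ×-dec walk? G w v k)
... | yes (w , e , p) = yes (step e p)
... | no none         = no λ { (step e p) → none (_ , e , p) }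

-- Distance

least : ∀ {P : ℕ → Set} → Decidable P → ∀ {k} → P k → Σ ℕ λ m → P m × (∀ m′ → P m′ → m ≤ m′)
least {P} P? {k} = go k (<-wellFounded k)
  where
  go : ∀ k → Acc _<_ k → P k → Σ ℕ λ m → P m × (∀ m′ → P m′ → m ≤ m′)
  go k (acc smaller) pk with ℕₚ.anyUpTo? P? k
  ... | yes (m , m<k , pm) = go m (smaller m<k) pm
  ... | no none            = k , pk , λ m′ pm′ → ℕₚ.≮⇒≥ λ m′<k → none (m′ , m′<k , pm′)

leastBy : ∀ {n} {P : Fin n → Set} → Decidable P → (f : Fin n → ℕ) →
          ∀ {w} → P w → Σ (Fin n) λ w → P w × (∀ {w′} → P w′ → f w ≤ f w′)
leastBy P? f {w} pw with least (λ m → any? λ w → P? w ×-dec (f w ℕₚ.≟ m)) (w , pw , refl)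
... | _ , (w₀ , pw₀ , refl) , minimal = w₀ , pw₀ , λ {w′} pw′ → minimal (f w′) (w′ , pw′ , refl)

module Distance {n : ℕ} (G : Graph n) (connected : Connected G) where

  abstract
    dist : Fin n → Fin n → ℕ
    dist u v = proj₁ (least (walk? G u v) (proj₂ (connected u v)))

    dist-walk : ∀ u v → Walk G u v (dist u v)
    dist-walk u v = proj₁ (proj₂ (least (walk? G u v) (proj₂ (connected u v))))

    dist-minimal : ∀ {u v k} → Walk G u v k → dist u v ≤ k
    dist-minimal {u} {v} = proj₂ (proj₂ (least (walk? G u v) (proj₂ (connected u v)))) _

  dist-triangle : ∀ u v w → dist u w ≤ dist u v + dist v w
  dist-triangle u v w = dist-minimal (dist-walk u v ++ʷ dist-walk v w)

  dist-refl : ∀ u → dist u u ≡ 0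
  dist-refl u = ℕₚ.n≤0⇒n≡0 (dist-minimal {u} here)

  dist-edge : ∀ {u v} → E G u v ≡ true → dist u v ≤ 1
  dist-edge e = dist-minimal (step e here)

  towards : ∀ u v → u ≡ v ⊎ ∃ λ u′ → E G u u′ ≡ true × dist u v ≡ suc (dist u′ v)
  towards u v with dist u v in d≡ | dist-walk u v
  ... | zero  | here = inj₁ refl
  ... | suc k | step {v = u′} e p = inj₂ (u′ , e , ℕₚ.≤-antisym (begin
    suc k                   ≡⟨ d≡ ⟨
    dist u v                ≤⟨ dist-triangle u u′ v ⟩
    dist u u′ + dist u′ v   ≤⟨ ℕₚ.+-monoˡ-≤ (dist u′ v) (dist-edge e) ⟩
    suc (dist u′ v)         ∎) (s≤s (dist-minimal p)))

  Between : Fin n → Fin n → Fin n → Set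
  Between u w v = dist u w + dist w v ≡ dist u v

  between? : ∀ u w v → Dec (Between u w v)
  between? u w v = dist u w + dist w v ℕₚ.≟ dist u v

  between-start : ∀ u v → Between u u v
  between-start u v = cong (_+ dist u v) (dist-refl u)

  interval⇒between : ∀ {u v w} → InInterval G u v w → Between u w v
  interval⇒between {u} {v} {w} (k , p , shortest , w∈p) =
    ℕₚ.≤-antisym (begin
      dist u w + dist w v  ≤⟨ ℕₚ.+-mono-≤ (dist-minimal prefix) (dist-minimal suffix) ⟩
      k₁ + k₂              ≡⟨ lengths ⟩
      k                    ≤⟨ shortest _ (dist-walk u v) ⟩
      dist u v             ∎)
    (dist-triangle u w v)
    where
    open SplitAt (splitAt p w∈p)

  between⇒interval : ∀ {u v w} → Between u w v → InInterval G u v w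
  between⇒interval {u} {v} {w} u-w-v =
    _ , dist-walk u w ++ʷ dist-walk w v , (λ k p → subst (_≤ k) (sym u-w-v) (dist-minimal p)) ,
    onWalk-junction (dist-walk u w) (dist-walk w v)

  between-step : ∀ {x w s u} → Between x w s → dist w s ≡ suc (dist u s) → dist w u ≤ 1 →
                 dist x u ≡ suc (dist x w) × Between x u s
  between-step {x} {w} {s} {u} x-w-s ws≡1+us wu≤1 = x-u , x-u-s
    where
    through-w : dist x s ≡ suc (dist x w) + dist u s
    through-w = trans (sym x-w-s) (trans (cong (dist x w +_) ws≡1+us) (ℕₚ.+-suc (dist x w) (dist u s)))
    x-u : dist x u ≡ suc (dist x w)
    x-u = ℕₚ.≤-antisym
      (begin
        dist x u             ≤⟨ dist-triangle x w u ⟩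
        dist x w + dist w u  ≤⟨ ℕₚ.+-monoʳ-≤ (dist x w) wu≤1 ⟩
        dist x w + 1         ≡⟨ ℕₚ.+-comm (dist x w) 1 ⟩
        suc (dist x w)       ∎)
      (ℕₚ.+-cancelʳ-≤ (dist u s) _ _ (begin
        suc (dist x w) + dist u s  ≡⟨ through-w ⟨
        dist x s                   ≤⟨ dist-triangle x u s ⟩
        dist x u + dist u s        ∎))
    x-u-s : Between x u s
    x-u-s = trans (cong (_+ dist u s) x-u) (sym through-w)

  Median : Fin n → Fin n → Fin n → Fin n → Set
  Median x y z w = Between x w y × Between x w z × Between y w z

-- Biconnected sets

x∈p-y⇒x≢y : ∀ {n} {p : Subset n} {x y : Fin n} → x ∈ p - y → x ≢ y
x∈p-y⇒x≢y {p = p} x∈p-y refl = not-removed p x∈p-y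
  where
  not-removed : ∀ {n} (p : Subset n) {x} → x ∉ p - x
  not-removed (_ Vec.∷ p) {Fin.zero}  ()
  not-removed (_ Vec.∷ p) {Fin.suc x} (Vec.there x∈) = not-removed p x∈

∈⇒lookup : ∀ {n} {S : Subset n} {x} → x ∈ S → lookup S x ≡ true
∈⇒lookup = Vecₚ.[]=⇒lookup

lookup⇒∈ : ∀ {n} {S : Subset n} {x} → lookup S x ≡ true → x ∈ S
lookup⇒∈ {S = S} {x} = Vecₚ.lookup⇒[]= x S

module _ {n : ℕ} {H : Graph n} where

  reachable-trans : ∀ {u v w} → Reachable H u v → Reachable H v w → Reachable H u w
  reachable-trans (_ , p) (_ , q) = _ , p ++ʷ q

  reachable-sym : ∀ {u v} → Reachable H u v → Reachable H v u
  reachable-sym (_ , p) = _ , reverseʷ p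

module _ {n : ℕ} (G : Graph n) where

  induce-edge : ∀ {S u v} → E G u v ≡ true → u ∈ S → v ∈ S → E (induce G S) u v ≡ true
  induce-edge {S} {u} {v} e u∈S v∈S rewrite e | ∈⇒lookup u∈S | ∈⇒lookup v∈S = refl

  adjacent-reachable : ∀ {S u v} → u ≡ v ⊎ E G u v ≡ true → u ∈ S → v ∈ S → Reachable (induce G S) u v
  adjacent-reachable (inj₁ refl) _   _   = 0 , here
  adjacent-reachable (inj₂ e)    u∈S v∈S = 1 , step (induce-edge e u∈S v∈S) here

  clique-adjacent : ∀ {S u v} → IsClique G S → u ∈ S → v ∈ S → u ≡ v ⊎ E G u v ≡ true
  clique-adjacent {u = u} {v} clique u∈S v∈S with u ≟ v
  ... | yes u≡v = inj₁ u≡v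
  ... | no u≢v  = inj₂ (clique u v u∈S v∈S u≢v)

  connectedOn-hub : ∀ S r → (∀ {u} → u ∈ S → Reachable (induce G S) u r) → ConnectedOn G S
  connectedOn-hub S r reach u v u∈S v∈S = reachable-trans (reach u∈S) (reachable-sym (reach v∈S))

  singleton-clique : ∀ x → IsClique G ⁅ x ⁆
  singleton-clique x a b a∈ b∈ a≢b = ⊥-elim (a≢b (trans (Subsetₚ.x∈⁅y⁆⇒x≡y x a∈) (sym (Subsetₚ.x∈⁅y⁆⇒x≡y x b∈))))

  edge⇒clique : ∀ {u v} → E G u v ≡ true → IsClique G (⁅ u ⁆ ∪ ⁅ v ⁆)
  edge⇒clique {u} {v} e a b a∈ b∈ a≢b with Subsetₚ.x∈p∪q⁻ ⁅ u ⁆ ⁅ v ⁆ a∈ | Subsetₚ.x∈p∪q⁻ ⁅ u ⁆ ⁅ v ⁆ b∈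
  ... | inj₁ a∈u | inj₁ b∈u = singleton-clique u a b a∈u b∈u a≢b
  ... | inj₂ a∈v | inj₂ b∈v = singleton-clique v a b a∈v b∈v a≢b
  ... | inj₁ a∈u | inj₂ b∈v rewrite Subsetₚ.x∈⁅y⁆⇒x≡y u a∈u | Subsetₚ.x∈⁅y⁆⇒x≡y v b∈v = e
  ... | inj₂ a∈v | inj₁ b∈u rewrite Subsetₚ.x∈⁅y⁆⇒x≡y v a∈v | Subsetₚ.x∈⁅y⁆⇒x≡y u b∈u = edge-sym {G = G} e

  clique⇒connectedOn : ∀ {S} → IsClique G S → ConnectedOn G S
  clique⇒connectedOn clique u v u∈S v∈S = adjacent-reachable (clique-adjacent clique u∈S v∈S) u∈S v∈S

  clique⇒biconnected : ∀ {S} → IsClique G S → Biconn G S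
  clique⇒biconnected {S} clique = clique⇒connectedOn clique , λ v _ → clique⇒connectedOn (clique-minus v)
    where
    clique-minus : ∀ v → IsClique G (S - v)
    clique-minus v x y x∈ y∈ = clique x y (Subsetₚ.p─q⊆p S ⁅ v ⁆ x∈) (Subsetₚ.p─q⊆p S ⁅ v ⁆ y∈)

  -- Every vertex of S ∪ T is adjacent to each vertex the cliques share, so any surviving shared vertex is a hub.
  cliqueUnion⇒biconnected : ∀ {S T a b} → IsClique G S → IsClique G T →
    a ∈ S → a ∈ T → b ∈ S → b ∈ T → a ≢ b → Biconn G (S ∪ T)
  cliqueUnion⇒biconnected {S} {T} {a} {b} S-clique T-clique a∈S a∈T b∈S b∈T a≢b =
    connectedOn-hub (S ∪ T) a (λ u∈ → hub a∈S a∈T u∈ u∈ (Subsetₚ.x∈p∪q⁺ (inj₁ a∈S))) , minus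
    where
    hub : ∀ {U r} → r ∈ S → r ∈ T → ∀ {u} → u ∈ S ∪ T → u ∈ U → r ∈ U → Reachable (induce G U) u r
    hub r∈S r∈T u∈ with Subsetₚ.x∈p∪q⁻ S T u∈
    ... | inj₁ u∈S = adjacent-reachable (clique-adjacent S-clique u∈S r∈S)
    ... | inj₂ u∈T = adjacent-reachable (clique-adjacent T-clique u∈T r∈T)
    minus : ∀ v → v ∈ S ∪ T → ConnectedOn G ((S ∪ T) - v)
    minus v _ with a ≟ v
    ... | no a≢v = connectedOn-hub _ a λ u∈ →
      hub a∈S a∈T (Subsetₚ.p─q⊆p _ _ u∈) u∈ (Subsetₚ.x∈p∧x≢y⇒x∈p-y (Subsetₚ.x∈p∪q⁺ (inj₁ a∈S)) a≢v)
    ... | yes refl = connectedOn-hub _ b λ u∈ →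
      hub b∈S b∈T (Subsetₚ.p─q⊆p _ _ u∈) u∈ (Subsetₚ.x∈p∧x≢y⇒x∈p-y (Subsetₚ.x∈p∪q⁺ (inj₁ b∈S)) (a≢b ∘ sym))

  -- Stated doubly negated, as maximality of a biconnected set is not decided here.
  extendToBlock : ∀ S → Biconn G S → ¬ ¬ (∃ λ T → S ⊆ T × IsBlock G T)
  extendToBlock S = go S (⊃-wellFounded S)
    where
    go : ∀ S → Acc _⊃_ S → Biconn G S → ¬ ¬ (∃ λ T → S ⊆ T × IsBlock G T)
    go S (acc larger) S-biconn noBlock = noBlock (S , (λ x∈ → x∈) , S-biconn , maximal)
      where
      maximal : ∀ T → S ⊆ T → Biconn G T → T ≡ S
      maximal T S⊆T T-biconn with S Subsetₚ.⊂? T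
      ... | yes S⊂T = ⊥-elim (go T (larger S⊂T) T-biconn λ (U , T⊆U , U-block) → noBlock (U , T⊆U ∘ S⊆T , U-block))
      ... | no S⊄T = Subsetₚ.⊆-antisym T⊆S S⊆T
        where
        T⊆S : T ⊆ S
        T⊆S {x} x∈T with x Subsetₚ.∈? S
        ... | yes x∈S = x∈S
        ... | no x∉S  = ⊥-elim (S⊄T (S⊆T , x , x∈T , x∉S))

-- S ∪ P is biconnected: after deleting a vertex v, each remaining vertex of P is still joined
-- along P to a or to b, for otherwise v lies on P both before and after it and P could be short-cut.
module Ear {n : ℕ} (G : Graph n) {H : Graph n} (H⊆G : ∀ {u v} → E H u v ≡ true → E G u v ≡ true)
           {S : Subset n} (clique : IsClique G S) {a b : Fin n} (a∈S : a ∈ S) (b∈S : b ∈ S) (a≢b : a ≢ b)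
           {k : ℕ} (P : Walk H a b k) (shortest : IsShortest H a b k) where

  T : Subset n
  T = S ∪ vertices P

  S⊆T : S ⊆ T
  S⊆T = Subsetₚ.x∈p∪q⁺ ∘ inj₁

  P⊆T : ∀ {y} → OnWalk y P → y ∈ T
  P⊆T = Subsetₚ.x∈p∪q⁺ ∘ inj₂ ∘ ∈-vertices⁺

  liftTo : ∀ U {u v l} (p : Walk H u v l) → (∀ {y} → OnWalk y p → y ∈ U) → Walk (induce G U) u v l
  liftTo U = mapWalk {H = induce G U} (_∈ U) λ u∈ v∈ e → induce-edge G (H⊆G e) u∈ v∈

  within-S : ∀ {U x r} → x ∈ S → r ∈ S → x ∈ U → r ∈ U → Reachable (induce G U) x r
  within-S x∈S r∈S = adjacent-reachable G (clique-adjacent G clique x∈S r∈S)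

  open SplitAt using (prefix; suffix; prefix⊆; suffix⊆)

  connected : ConnectedOn G T
  connected = connectedOn-hub G T a reach-a
    where
    from-P : ∀ {x} (s : SplitAt x P) → Reachable (induce G T) x a
    from-P s = _ , reverseʷ (liftTo T (prefix s) (P⊆T ∘ prefix⊆ s))
    reach-a : ∀ {x} → x ∈ T → Reachable (induce G T) x a
    reach-a x∈T with Subsetₚ.x∈p∪q⁻ S (vertices P) x∈T
    ... | inj₁ x∈S = within-S x∈S a∈S x∈T (S⊆T a∈S)
    ... | inj₂ x∈P = from-P (splitAt P (∈-vertices⁻ P x∈P))

  avoids : ∀ {x v} (s : SplitAt x P) → x ≢ v → ¬ OnWalk v (prefix s) ⊎ ¬ OnWalk v (suffix s)
  avoids {x} {v} s x≢v with onWalk? v (prefix s) | onWalk? v (suffix s)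
  ... | no v∉prefix  | _            = inj₁ v∉prefix
  ... | yes _        | no v∉suffix  = inj₂ v∉suffix
  ... | yes v∈prefix | yes v∈suffix with shortcut (prefix s) (suffix s) (x≢v ∘ sym) v∈prefix v∈suffix
  ...   | m , m<k , Q =
    ⊥-elim (ℕₚ.<-irrefl refl (ℕₚ.<-≤-trans (subst (m <_) (SplitAt.lengths s) m<k) (shortest m Q)))

  connected-minus : ∀ v → ConnectedOn G (T - v)
  connected-minus v = connectedOn-hub G (T - v) r reach-r
    where
    hub : ∃ λ r → r ∈ S × r ≢ v
    hub with a ≟ v
    ... | no a≢v   = a , a∈S , a≢v
    ... | yes refl = b , b∈S , a≢b ∘ sym
    r : Fin n
    r = proj₁ hub
    r∈S : r ∈ S
    r∈S = proj₁ (proj₂ hub)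
    in-T-v : ∀ {y} → y ∈ T → y ≢ v → y ∈ T - v
    in-T-v = Subsetₚ.x∈p∧x≢y⇒x∈p-y
    r∈T-v : r ∈ T - v
    r∈T-v = in-T-v (S⊆T r∈S) (proj₂ (proj₂ hub))
    from-S : ∀ {x} → x ∈ S → x ≢ v → Reachable (induce G (T - v)) x r
    from-S x∈S x≢v = within-S x∈S r∈S (in-T-v (S⊆T x∈S) x≢v) r∈T-v
    from-P : ∀ {x} (s : SplitAt x P) → x ≢ v → Reachable (induce G (T - v)) x r
    from-P s x≢v with avoids s x≢v
    ... | inj₁ v∉prefix = reachable-trans
      (_ , reverseʷ (liftTo (T - v) (prefix s) λ on → in-T-v (P⊆T (prefix⊆ s on)) λ { refl → v∉prefix on }))
      (from-S a∈S λ { refl → v∉prefix (onWalk-start (prefix s)) })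
    ... | inj₂ v∉suffix = reachable-trans
      (_ , liftTo (T - v) (suffix s) λ on → in-T-v (P⊆T (suffix⊆ s on)) λ { refl → v∉suffix on })
      (from-S b∈S λ { refl → v∉suffix (onWalk-end (suffix s)) })
    reach-r : ∀ {x} → x ∈ T - v → Reachable (induce G (T - v)) x r
    reach-r {x} x∈T-v with Subsetₚ.x∈p∪q⁻ S (vertices P) (Subsetₚ.p─q⊆p _ _ x∈T-v)
    ... | inj₁ x∈S = from-S x∈S (x∈p-y⇒x≢y x∈T-v)
    ... | inj₂ x∈P = from-P (splitAt P (∈-vertices⁻ P x∈P)) (x∈p-y⇒x≢y x∈T-v)

  biconnected : Biconn G T
  biconnected = connected , λ v _ → connected-minus v

-- Blocks of a block graph

module _ {n : ℕ} (G : Graph n) (B : Subset n) where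

  deleteEdges⊆ : ∀ {u v} → E (deleteEdges G B) u v ≡ true → E G u v ≡ true
  deleteEdges⊆ {u} {v} e with E G u v
  ... | true  = refl
  ... | false = e

  deleteEdges-keeps : ∀ {u v} → E G u v ≡ true → ¬ (u ∈ B × v ∈ B) → E (deleteEdges G B) u v ≡ true
  deleteEdges-keeps {u} {v} e outside with lookup B u in u∈? | lookup B v in v∈?
  ... | true  | true  = ⊥-elim (outside (lookup⇒∈ u∈? , lookup⇒∈ v∈?))
  ... | true  | false rewrite e = refl
  ... | false | _     rewrite e = refl

  deleteEdges-inside : ∀ {u v} → u ∈ B → v ∈ B → E (deleteEdges G B) u v ≢ true
  deleteEdges-inside {u} {v} u∈B v∈B
    rewrite ∈⇒lookup {S = B} u∈B | ∈⇒lookup {S = B} v∈B with E G u v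
  ... | true  = λ ()
  ... | false = λ ()

module BlockStructure {n : ℕ} (G : Graph n) (connected : Connected G) (blockGraph : IsBlockGraph G)
  {t : ℕ} (B : Fin t → Subset n) (isBlock : ∀ i → IsBlock G (B i))
  (B-injective : ∀ i j → B i ≡ B j → i ≡ j) (B-complete : ∀ S → IsBlock G S → ∃ λ i → B i ≡ S)
  (C : (i : Fin t) → Components (deleteEdges G (B i))) where

  open Distance G connected

  maximal : ∀ i {T} → B i ⊆ T → Biconn G T → T ≡ B i
  maximal i = proj₂ (isBlock i) _

  edgeInBlock : ∀ {u v} → E G u v ≡ true → ¬ ¬ (∃ λ i → u ∈ B i × v ∈ B i)
  edgeInBlock {u} {v} e noBlock = extendToBlock G (⁅ u ⁆ ∪ ⁅ v ⁆) (clique⇒biconnected G (edge⇒clique G e)) inBlock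
    where
    inBlock : ¬ ∃ λ T → ⁅ u ⁆ ∪ ⁅ v ⁆ ⊆ T × IsBlock G T
    inBlock (T , uv⊆T , T-block) with B-complete T T-block
    ... | i , refl = noBlock (i , uv⊆T (Subsetₚ.x∈p∪q⁺ (inj₁ (Subsetₚ.x∈⁅x⁆ u))) ,
                                 uv⊆T (Subsetₚ.x∈p∪q⁺ (inj₂ (Subsetₚ.x∈⁅x⁆ v))))

  -- A single vertex is biconnected, so no block is empty.
  block-nonempty : Fin n → ∀ i → ∃ λ b → b ∈ B i
  block-nonempty x i with any? (λ y → y Subsetₚ.∈? B i)
  ... | yes b = b
  ... | no empty = ⊥-elim (empty (x , subst (x ∈_) ⁅x⁆≡Bi (Subsetₚ.x∈⁅x⁆ x)))
    where
    ⁅x⁆≡Bi : ⁅ x ⁆ ≡ B i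
    ⁅x⁆≡Bi = maximal i (λ {y} y∈ → ⊥-elim (empty (y , y∈))) (clique⇒biconnected G (singleton-clique G x))

  clique : ∀ i → IsClique G (B i)
  clique i = blockGraph (B i) (isBlock i)

  blocks-meet-once : ∀ {i j a b} → i ≢ j → a ∈ B i → a ∈ B j → b ∈ B i → b ∈ B j → a ≡ b
  blocks-meet-once {i} {j} {a} {b} i≢j a∈i a∈j b∈i b∈j with a ≟ b
  ... | yes a≡b = a≡b
  ... | no a≢b  = ⊥-elim (i≢j (B-injective i j (trans (sym (maximal i (Subsetₚ.p⊆p∪q (B j)) union))
                                                       (maximal j (Subsetₚ.q⊆p∪q (B i) (B j)) union))))
    where
    union : Biconn G (B i ∪ B j)
    union = cliqueUnion⇒biconnected G (clique i) (clique j) a∈i a∈j b∈i b∈j a≢b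

  module Cut (i : Fin t) where

    H : Graph n
    H = deleteEdges G (B i)

    component : Fin n → Fin (p (C i))
    component = comp (C i)

    reachable⇒component : ∀ {a b} → Reachable H a b → component a ≡ component b
    reachable⇒component = Equivalence.from (exact (C i) _ _)

    component⇒reachable : ∀ {a b} → component a ≡ component b → Reachable H a b
    component⇒reachable = Equivalence.to (exact (C i) _ _)

    component-edge : ∀ {a b} → E G a b ≡ true → ¬ (a ∈ B i × b ∈ B i) → component a ≡ component b
    component-edge e outside = reachable⇒component (1 , step (deleteEdges-keeps G (B i) e outside) here)

    component-onWalk : ∀ {u v k y} (p : Walk H u v k) → OnWalk y p → component y ≡ component u
    component-onWalk p y∈p = sym (reachable⇒component (_ , SplitAt.prefix (splitAt p y∈p)))

    gate-exists : ∀ x → ∃ λ g → g ∈ B i × component g ≡ component x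
    gate-exists x with block-nonempty x i
    ... | b , b∈B = first-in-block (proj₂ (connected x b)) b∈B
      where
      first-in-block : ∀ {x b k} → Walk G x b k → b ∈ B i → ∃ λ g → g ∈ B i × component g ≡ component x
      first-in-block {x} here b∈B = x , b∈B , refl
      first-in-block {x} (step e p) b∈B with x Subsetₚ.∈? B i
      ... | yes x∈B = x , x∈B , refl
      ... | no x∉B  = let g , g∈B , g~v = first-in-block p b∈B
                      in g , g∈B , trans g~v (sym (component-edge e (x∉B ∘ proj₁)))

    -- A second vertex of B i in the same component would yield an ear, contradicting maximality.
    block-meets-component-once : ∀ {a b} → a ∈ B i → b ∈ B i → component a ≡ component b → a ≡ b
    block-meets-component-once {a} {b} a∈B b∈B a~b with a ≟ b
    ... | yes a≡b = a≡b
    ... | no a≢b with least (walk? H a b) (proj₂ (component⇒reachable a~b))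
    ...   | k , P , shortest = ⊥-elim (no-ear P λ on → subst (_ ∈_) ear≡B (E.P⊆T on))
      where
      module E = Ear G (deleteEdges⊆ G (B i)) (clique i) a∈B b∈B a≢b P shortest
      ear≡B : E.T ≡ B i
      ear≡B = maximal i E.S⊆T E.biconnected
      no-ear : ∀ {k} (P : Walk H a b k) → (∀ {y} → OnWalk y P → y ∈ B i) → ⊥
      no-ear here       _     = a≢b refl
      no-ear (step e P) P⊆B = deleteEdges-inside G (B i) a∈B (P⊆B (later e P (onWalk-start P))) e

    gate : Fin n → Fin n
    gate x = proj₁ (gate-exists x)

    gate-∈ : ∀ x → gate x ∈ B i
    gate-∈ x = proj₁ (proj₂ (gate-exists x))

    gate-component : ∀ x → component (gate x) ≡ component x
    gate-component x = proj₂ (proj₂ (gate-exists x))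

    gate-unique : ∀ {g x} → g ∈ B i → component g ≡ component x → g ≡ gate x
    gate-unique {g} {x} g∈B g~x = block-meets-component-once g∈B (gate-∈ x) (trans g~x (sym (gate-component x)))

    gate-fixed : ∀ {x} → x ∈ B i → gate x ≡ x
    gate-fixed x∈B = sym (gate-unique x∈B refl)

    dist-gate-fixed : ∀ {x} → x ∈ B i → dist x (gate x) ≡ 0
    dist-gate-fixed {x} x∈B = trans (cong (dist x) (gate-fixed x∈B)) (dist-refl x)

    gate-cong : ∀ {x y} → component x ≡ component y → gate x ≡ gate y
    gate-cong {x} {y} x~y = gate-unique (gate-∈ x) (trans (gate-component x) x~y)

    dist-within-block : ∀ {a b} → a ∈ B i → b ∈ B i → dist a b ≤ 1
    dist-within-block {a} {b} a∈B b∈B with clique-adjacent G (clique i) a∈B b∈B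
    ... | inj₁ refl = ℕₚ.≤-trans (ℕₚ.≤-reflexive (dist-refl a)) z≤n
    ... | inj₂ e    = dist-edge e

    -- Every walk between different components crosses B i, entering and leaving it through the gates.
    dist-across-≥ : ∀ {x y k} → Walk G x y k → component x ≢ component y →
                    dist x (gate x) + suc (dist (gate y) y) ≤ k
    dist-across-≥ here x≁y = ⊥-elim (x≁y refl)
    dist-across-≥ {x} {y} (step {v = v} {k = k} e p) x≁y with (x Subsetₚ.∈? B i) ×-dec (v Subsetₚ.∈? B i)
    ... | yes (x∈B , v∈B) = begin
      dist x (gate x) + suc (dist (gate y) y)   ≡⟨ cong (_+ suc (dist (gate y) y)) (dist-gate-fixed x∈B) ⟩
      suc (dist (gate y) y)                     ≤⟨ s≤s (gate-closer v∈B p) ⟩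
      suc k                                     ∎
      where
      gate-closer : ∀ {v k} → v ∈ B i → Walk G v y k → dist (gate y) y ≤ k
      gate-closer {v} v∈B p with component v ≟ component y
      ... | yes v~y = subst (λ g → dist g y ≤ _) (gate-unique v∈B v~y) (dist-minimal p)
      ... | no v≁y  = ℕₚ.≤-trans (ℕₚ.n≤1+n _) (ℕₚ.m+n≤o⇒n≤o (dist v (gate v)) (dist-across-≥ p v≁y))
    ... | no outside = begin
      dist x (gate x) + suc (dist (gate y) y)             ≤⟨ ℕₚ.+-monoˡ-≤ _ (dist-triangle x v (gate x)) ⟩
      dist x v + dist v (gate x) + suc (dist (gate y) y)  ≤⟨ ℕₚ.+-monoˡ-≤ _ (ℕₚ.+-monoˡ-≤ _ (dist-edge e)) ⟩
      suc (dist v (gate x) + suc (dist (gate y) y))       ≡⟨ cong (λ g → suc (dist v g + _)) (gate-cong x~v) ⟩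
      suc (dist v (gate v) + suc (dist (gate y) y))       ≤⟨ s≤s (dist-across-≥ p (x≁y ∘ trans x~v)) ⟩
      suc k                                               ∎
      where
      x~v : component x ≡ component v
      x~v = component-edge e outside

    dist-across : ∀ {x y} → component x ≢ component y → dist x y ≡ dist x (gate x) + suc (dist (gate y) y)
    dist-across {x} {y} x≁y = ℕₚ.≤-antisym (begin
      dist x y                                           ≤⟨ dist-triangle x (gate x) y ⟩
      dist x (gate x) + dist (gate x) y                  ≤⟨ ℕₚ.+-monoʳ-≤ _ (dist-triangle (gate x) (gate y) y) ⟩
      dist x (gate x) + (dist (gate x) (gate y) + dist (gate y) y)
        ≤⟨ ℕₚ.+-monoʳ-≤ _ (ℕₚ.+-monoˡ-≤ _ (dist-within-block (gate-∈ x) (gate-∈ y))) ⟩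
      dist x (gate x) + suc (dist (gate y) y)            ∎)
      (dist-across-≥ (dist-walk x y) x≁y)

    dist-from-block : ∀ {b y} → b ∈ B i → component b ≢ component y → dist b y ≡ suc (dist (gate y) y)
    dist-from-block b∈B b≁y = trans (dist-across b≁y) (cong (_+ _) (dist-gate-fixed b∈B))

    dist-to-block : ∀ {x b} → b ∈ B i → component x ≢ component b → dist x b ≡ suc (dist x (gate x))
    dist-to-block {x} {b} b∈B x≁b = begin-equality
      dist x b                                  ≡⟨ dist-across x≁b ⟩
      dist x (gate x) + suc (dist (gate b) b)   ≡⟨ cong (λ g → dist x (gate x) + suc (dist g b)) (gate-fixed b∈B) ⟩
      dist x (gate x) + suc (dist b b)          ≡⟨ cong (λ d → dist x (gate x) + suc d) (dist-refl b) ⟩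
      dist x (gate x) + 1                       ≡⟨ ℕₚ.+-comm _ 1 ⟩
      suc (dist x (gate x))                     ∎

    closer-gate : ∀ {w y′ y} → w ∈ B i → y′ ∈ B i → dist w y ≡ suc (dist y′ y) → component y ≡ component y′
    closer-gate {w} {y′} {y} w∈B y′∈B w-y with component y′ ≟ component y
    ... | yes y′~y = sym y′~y
    ... | no y′≁y  = ⊥-elim (ℕₚ.<-irrefl refl (begin-strict
      dist w y                            ≤⟨ dist-triangle w (gate y) y ⟩
      dist w (gate y) + dist (gate y) y   ≤⟨ ℕₚ.+-monoˡ-≤ _ (dist-within-block w∈B (gate-∈ y)) ⟩
      suc (dist (gate y) y)               ≡⟨ dist-from-block y′∈B y′≁y ⟨
      dist y′ y                           <⟨ ℕₚ.n<1+n _ ⟩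
      suc (dist y′ y)                     ≡⟨ w-y ⟨
      dist w y                            ∎))

    not-between : ∀ {a b w} → component w ≢ component a → component w ≢ component b →
                  component a ≢ component b → ¬ Between a w b
    not-between {a} {b} {w} w≁a w≁b a≁b a-w-b = ℕₚ.<-irrefl refl (begin-strict
      dist a b                          ≡⟨ dist-across a≁b ⟩
      A + suc Db                        <⟨ ℕₚ.+-monoʳ-< A (s≤s (ℕₚ.≤-trans (ℕₚ.m≤n+m _ Y) (ℕₚ.m≤n+m _ X))) ⟩
      A + (suc X + (Y + suc Db))        ≡⟨ ℕₚ.+-assoc A (suc X) _ ⟨
      (A + suc X) + (Y + suc Db)        ≡⟨ cong₂ _+_ (dist-across (w≁a ∘ sym)) (dist-across w≁b) ⟨
      dist a w + dist w b               ≡⟨ a-w-b ⟩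
      dist a b                          ∎)
      where
      A X Y Db : ℕ
      A = dist a (gate a)
      X = dist (gate w) w
      Y = dist w (gate w)
      Db = dist (gate b) b

    gate-between : ∀ {y z} → component y ≢ component z → Between y (gate z) z
    gate-between {y} {z} y≁z = begin-equality
      dist y (gate z) + dist (gate z) z         ≡⟨ cong (_+ dist (gate z) z) (dist-to-block (gate-∈ z) y≁gz) ⟩
      suc (dist y (gate y)) + dist (gate z) z   ≡⟨ ℕₚ.+-suc _ _ ⟨
      dist y (gate y) + suc (dist (gate z) z)   ≡⟨ dist-across y≁z ⟨
      dist y z                                  ∎
      where
      y≁gz : component y ≢ component (gate z)
      y≁gz y~gz = y≁z (trans y~gz (gate-component z))

    farther⇒other-component : ∀ {x v w} → v ∈ B i → w ∈ B i → component v ≢ component w →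
                              dist x v ≡ suc (dist x w) → component x ≢ component v
    farther⇒other-component {x} {v} {w} v∈B w∈B v≁w x-v x~v =
      ℕₚ.<⇒≢ (ℕₚ.m<n⇒m<1+n (ℕₚ.n<1+n (dist x w))) (begin-equality
        dist x w               ≡⟨ dist-to-block w∈B (v≁w ∘ trans (sym x~v)) ⟩
        suc (dist x (gate x))  ≡⟨ cong (suc ∘ dist x) (gate-unique v∈B (sym x~v)) ⟨
        suc (dist x v)         ≡⟨ cong suc x-v ⟩
        suc (suc (dist x w))   ∎)

    -- w: a common point of geodesics from x to y and from x to z, chosen closest to y;
    -- y′: the next vertex on a geodesic from w to y.
    step-separates : ∀ {x y z w y′} →
      Between x w y → Between x w z → ¬ Between y w z →
      (∀ {w′} → Between x w′ y → Between x w′ z → dist w y ≤ dist w′ y) →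
      w ∈ B i → y′ ∈ B i → w ≢ y′ → dist w y ≡ suc (dist y′ y) →
      AllDistinct (component x) (component y) (component z)
    step-separates {x} {y} {z} {w} {y′} x-w-y x-w-z ¬y-w-z closest w∈B y′∈B w≢y′ w-y = x≁y , x≁z , y≁z
      where
      y~y′ : component y ≡ component y′
      y~y′ = closer-gate w∈B y′∈B w-y
      w≁y′ : component w ≢ component y′
      w≁y′ = w≢y′ ∘ block-meets-component-once w∈B y′∈B
      w≁z : component w ≢ component z
      w≁z w~z = ¬y-w-z (subst (λ v → Between y v z) (sym (gate-unique w∈B w~z)) (gate-between y≁z))
        where
        y≁z : component y ≢ component z
        y≁z y~z = w≁y′ (trans w~z (trans (sym y~z) y~y′))
      step-y : dist x y′ ≡ suc (dist x w) × Between x y′ y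
      step-y = between-step x-w-y w-y (dist-within-block w∈B y′∈B)
      step-z : dist x (gate z) ≡ suc (dist x w) × Between x (gate z) z
      step-z = between-step x-w-z (dist-from-block w∈B w≁z) (dist-within-block w∈B (gate-∈ z))
      y≁z : component y ≢ component z
      y≁z y~z = ℕₚ.<-irrefl refl (begin-strict
        dist y′ y       <⟨ ℕₚ.n<1+n _ ⟩
        suc (dist y′ y) ≡⟨ w-y ⟨
        dist w y        ≤⟨ closest (proj₂ step-y) (subst (λ v → Between x v z) (sym y′≡gz) (proj₂ step-z)) ⟩
        dist y′ y       ∎)
        where
        y′≡gz : y′ ≡ gate z
        y′≡gz = gate-unique y′∈B (trans (sym y~y′) y~z)
      x≁y : component x ≢ component y
      x≁y x~y = farther⇒other-component y′∈B w∈B (w≁y′ ∘ sym) (proj₁ step-y) (trans x~y y~y′)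
      x≁z : component x ≢ component z
      x≁z x~z = farther⇒other-component (gate-∈ z) w∈B (λ gz~w → w≁z (trans (sym gz~w) (gate-component z)))
                  (proj₁ step-z) (trans x~z (sym (gate-component z)))

  open Cut using (component)

  Separates : Fin t → Fin n → Fin n → Fin n → Set
  Separates i x y z = AllDistinct (component i x) (component i y) (component i z)

  separates⇒noMedian : ∀ {i x y z} → Separates i x y z → ∀ w → ¬ Median x y z w
  separates⇒noMedian {i} {x} {y} {z} (x≁y , x≁z , y≁z) w (x-w-y , x-w-z , y-w-z)
    with component i w ≟ component i x | component i w ≟ component i y
  ... | yes w~x | _       = Cut.not-between i (x≁y ∘ trans (sym w~x)) (x≁z ∘ trans (sym w~x)) y≁z y-w-z
  ... | no w≁x  | yes w~y = Cut.not-between i w≁x (y≁z ∘ trans (sym w~y)) x≁z x-w-z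
  ... | no w≁x  | no w≁y  = Cut.not-between i w≁x w≁y x≁y x-w-y

  noMedian⇒separated : ∀ {x y z} → (∀ w → ¬ Median x y z w) → ¬ ¬ ∃ λ i → Separates i x y z
  noMedian⇒separated {x} {y} {z} noMedian unseparated
    with leastBy (λ w → between? x w y ×-dec between? x w z) (λ w → dist w y) (between-start x y , between-start x z)
  ... | w , (x-w-y , x-w-z) , closest with between? y w z
  ...   | yes y-w-z = noMedian w (x-w-y , x-w-z , y-w-z)
  ...   | no ¬y-w-z with towards w y
  ...     | inj₁ refl = ¬y-w-z (between-start y z)
  ...     | inj₂ (y′ , e , w-y) = edgeInBlock e λ (i , w∈B , y′∈B) → unseparated (i ,
    Cut.step-separates i x-w-y x-w-z ¬y-w-z (λ x-w′-y x-w′-z → closest (x-w′-y , x-w′-z))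
                       w∈B y′∈B (λ { refl → no-loop {G = G} e }) w-y)

  module _ {i j : Fin t} (i≢j : i ≢ j) where

    private
      module I = Cut i
      module J = Cut j

    -- B j is a clique meeting B i in at most one vertex, so G ∖ B i keeps all its edges.
    block-within-component : ∀ {u r} → u ∈ B j → r ∈ B j → I.component u ≡ I.component r
    block-within-component {u} {r} u∈Bj r∈Bj with clique-adjacent G (clique j) u∈Bj r∈Bj
    ... | inj₁ refl = refl
    ... | inj₂ e    = I.component-edge e λ (u∈Bi , r∈Bi) →
      no-loop {G = G} (subst (λ v → E G u v ≡ true) (sym (blocks-meet-once i≢j u∈Bi u∈Bj r∈Bi r∈Bj)) e)

    -- The walk a ⇝ gate a — gate b ⇝ b of G avoids B j, which lies in the component of r.
    joined-outside : ∀ {r a b} → r ∈ B j → I.component a ≢ I.component r → I.component b ≢ I.component r →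
                     I.component a ≢ I.component b → J.component a ≡ J.component b
    joined-outside {r} {a} {b} r∈Bj a≁r b≁r a≁b =
      J.reachable⇒component (reachable-trans (reachable-trans a-to-gate gates-step) gate-to-b)
      where
      outside : ∀ {u} → I.component u ≢ I.component r → u ∉ B j
      outside u≁r u∈Bj = u≁r (block-within-component u∈Bj r∈Bj)
      gate≁r : ∀ {u} → I.component u ≢ I.component r → I.component (I.gate u) ≢ I.component r
      gate≁r {u} u≁r = u≁r ∘ trans (sym (I.gate-component u))
      to-J : ∀ {u v k} (p : Walk I.H u v k) → I.component u ≢ I.component r → Walk J.H u v k
      to-J {u} p u≁r = mapWalk {G = I.H} (λ y → I.component y ≡ I.component u)
        (λ y~u _ e → deleteEdges-keeps G (B j) (deleteEdges⊆ G (B i) e) (outside (u≁r ∘ trans (sym y~u)) ∘ proj₁))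
        p (I.component-onWalk p)
      a-to-gate : Reachable J.H a (I.gate a)
      a-to-gate = _ , to-J (proj₂ (I.component⇒reachable (sym (I.gate-component a)))) a≁r
      gate-to-b : Reachable J.H (I.gate b) b
      gate-to-b = _ , to-J (proj₂ (I.component⇒reachable (I.gate-component b))) (gate≁r b≁r)
      gates-edge : E G (I.gate a) (I.gate b) ≡ true
      gates-edge = clique i _ _ (I.gate-∈ a) (I.gate-∈ b)
        λ ga≡gb → a≁b (trans (sym (I.gate-component a)) (trans (cong I.component ga≡gb) (I.gate-component b)))
      gates-step : Reachable J.H (I.gate a) (I.gate b)
      gates-step = 1 , step (deleteEdges-keeps G (B j) gates-edge (outside (gate≁r a≁r) ∘ proj₁)) here

  separator-unique : ∀ {i j x y z} → Separates i x y z → Separates j x y z → i ≡ j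
  separator-unique {i} {j} {x} {y} {z} (x≁y , x≁z , y≁z) (x≁ʲy , x≁ʲz , y≁ʲz) with i ≟ j
  ... | yes i≡j = i≡j
  ... | no i≢j with block-nonempty x j
  ...   | r , r∈Bj with component i x ≟ component i r | component i y ≟ component i r
  ...     | yes x~r | _       =
    ⊥-elim (y≁ʲz (joined-outside i≢j r∈Bj (x≁y ∘ trans x~r ∘ sym) (x≁z ∘ trans x~r ∘ sym) y≁z))
  ...     | no x≁r  | yes y~r = ⊥-elim (x≁ʲz (joined-outside i≢j r∈Bj x≁r (y≁z ∘ trans y~r ∘ sym) x≁z))
  ...     | no x≁r  | no y≁r  = ⊥-elim (x≁ʲy (joined-outside i≢j r∈Bj x≁r y≁r x≁y))

  SeparatedTriple : Fin n × Fin n × Fin n → Set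
  SeparatedTriple (x , y , z) = x Fin.< y × y Fin.< z × ∃ λ i → Separates i x y z

  separator? : ∀ x y z → Dec (∃ λ i → Separates i x y z)
  separator? x y z = any? λ i → allDistinct? (component i x) (component i y) (component i z)

  separatedTriple? : Decidable SeparatedTriple
  separatedTriple? (x , y , z) = x <? y ×-dec (y <? z ×-dec separator? x y z)

  nonModular⇔separatedTriple : ∀ xyz → NonModular G xyz ⇔ SeparatedTriple xyz
  nonModular⇔separatedTriple (x , y , z) = mk⇔
    (λ (x<y , y<z , noMedian) → x<y , y<z , separated λ w (x-w-y , x-w-z , y-w-z) →
       noMedian (w , between⇒interval x-w-y , between⇒interval x-w-z , between⇒interval y-w-z))
    (λ (x<y , y<z , i , separates) → x<y , y<z , λ (w , x-w-y , x-w-z , y-w-z) →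
       separates⇒noMedian separates w (interval⇒between x-w-y , interval⇒between x-w-z , interval⇒between y-w-z))
    where
    separated : (∀ w → ¬ Median x y z w) → ∃ λ i → Separates i x y z
    separated noMedian with separator? x y z
    ... | yes separator = separator
    ... | no none       = ⊥-elim (noMedian⇒separated noMedian none)

  count-separatedTriples : ∑³ (λ x y z → 𝟙 (separatedTriple? (x , y , z))) ≡ ∑ (λ i → N₃ (C i))
  count-separatedTriples = begin-equality
    ∑³ (λ x y z → 𝟙 (separatedTriple? (x , y , z)))
      ≡⟨ ∑³-cong pointwise ⟩
    ∑³ (λ x y z → ∑ λ i → distinct (component i x) (component i y) (component i z) * ascending x y z)
      ≡⟨ ∑³-∑-comm (λ i x y z → distinct (component i x) (component i y) (component i z) * ascending x y z) ⟩
    ∑ (λ i → ∑³ λ x y z → distinct (component i x) (component i y) (component i z) * ascending x y z)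
      ≡⟨ ∑-cong (λ i → N₃-triples (C i)) ⟨
    ∑ (λ i → N₃ (C i)) ∎
    where
    pointwise : ∀ x y z → 𝟙 (separatedTriple? (x , y , z)) ≡
                ∑ (λ i → distinct (component i x) (component i y) (component i z) * ascending x y z)
    pointwise x y z = begin-equality
      𝟙 (separatedTriple? (x , y , z))
        ≡⟨ 𝟙-× (x <? y) _ ⟩
      𝟙 (x <? y) * 𝟙 (y <? z ×-dec separator? x y z)
        ≡⟨ cong (𝟙 (x <? y) *_) (𝟙-× (y <? z) (separator? x y z)) ⟩
      𝟙 (x <? y) * (𝟙 (y <? z) * 𝟙 (separator? x y z))
        ≡⟨ rearrange (𝟙 (x <? y)) (𝟙 (y <? z)) (𝟙 (separator? x y z)) ⟩
      𝟙 (separator? x y z) * ascending x y z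
        ≡⟨ cong (_* ascending x y z) (𝟙-any? _ λ i j sᵢ sⱼ → separator-unique sᵢ sⱼ) ⟩
      ∑ (λ i → distinct (component i x) (component i y) (component i z)) * ascending x y z
        ≡⟨ ∑-distribʳ (ascending x y z) (λ i → distinct (component i x) (component i y) (component i z)) ⟩
      ∑ (λ i → distinct (component i x) (component i y) (component i z) * ascending x y z) ∎
      where
      rearrange : ∀ a b c → a * (b * c) ≡ c * (a * b)
      rearrange = solve-∀

mainTheorem5 : ∀ {n} (G : Graph n) → Connected G → IsBlockGraph G →
    (t : ℕ) (B : Fin t → Subset n) →
    (∀ i → IsBlock G (B i)) →
    (∀ i j → B i ≡ B j → i ≡ j) →
    (∀ S → IsBlock G S → ∃ λ i → B i ≡ S) →
    (C : (i : Fin t) → Components (deleteEdges G (B i))) →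
    Count (NonModular G) (∑ λ i → N₃ (C i))
mainTheorem5 G connected blockGraph t B isBlock B-injective B-complete C =
  subst (Count (NonModular G)) count-separatedTriples (count-decidable separatedTriple? nonModular⇔separatedTriple)
  where open BlockStructure G connected blockGraph B isBlock B-injective B-complete C
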